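{- Let $n\ge 1$ and $\mathcal{F}\subseteq 2^{[n]}$. Then $\mathcal{F}$ is s-extremal and has Vapnik–Chervonenkis dimension at most $1$ if and only if the undirected version of the inclusion graph $G_{\mathcal{F}}$ is a tree and all edge labels of $G_{\mathcal{F}}$ are pairwise different.
   Context: $[n]=\{1,\dots,n\}$. A family $\mathcal{F}\subseteq 2^{[n]}$ shatters $S\subseteq[n]$ if $\{F\cap S: F\in\mathcal{F}\}=2^S$; $Sh(\mathcal{F})$ is the family of all sets shattered by $\mathcal{F}$. One always has $|Sh(\mathcal{F})|\ge|\mathcal{F}|$, and $\mathcal{F}$ is called s-extremal if $|Sh(\mathcal{F})|=|\mathcal{F}|$. The Vapnik–Chervonenkis dimension of $\mathcal{F}$ is the maximum cardinality of a set shattered by $\mathcal{F}$. The inclusion graph $G_{\mathcal{F}}$ has vertex set $\mathcal{F}$, and for $G,F\in\mathcal{F}$ there is a directed edge from $G$ to $F$ labelled $j\in[n]$ exactly when $j\notin G$ and $F=G\cup\{j\}$; its undirected version forgets edge directions but keeps labels. -}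

module Defs where

open import Data.Nat using (ℕ; _≤_; _≥_)
open import Data.Fin using (Fin)
open import Data.Fin.Subset using (Subset; _∩_; _∪_; ⁅_⁆; _⊆_; ∣_∣)
  renaming (_∉_ to _∉ₛ_)
open import Data.List using (List; []; _∷_; length; _∷ʳ_)
open import Data.List.Membership.Propositional using (_∈_)
open import Data.List.Relation.Unary.All using (All)
open import Data.List.Relation.Unary.Unique.Propositional using (Unique)
open import Data.List.Relation.Unary.Linked using (Linked)
open import Data.Product using (Σ; ∃; _×_; _,_)
open import Data.Sum using (_⊎_)
open import Relation.Binary.PropositionalEquality using (_≡_)
open import Function.Bundles using (_⇔_)

-- A family 𝓕 ⊆ 2^[n] is a duplicate-free list of subsets of Fin n
-- (Data.Fin.Subset); its cardinality is the length of the list.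

Shatters : ∀ {n} → List (Subset n) → Subset n → Set
Shatters 𝓕 S = ∀ T → T ⊆ S → ∃ λ F → F ∈ 𝓕 × F ∩ S ≡ T

-- s-extremal: |Sh(𝓕)| = |𝓕|, where Sh(𝓕) is given by a duplicate-free
-- list enumerating exactly the shattered sets.
SExtremal : ∀ {n} → List (Subset n) → Set
SExtremal {n} 𝓕 =
  Σ (List (Subset n)) λ Sh →
    Unique Sh × (∀ S → (S ∈ Sh) ⇔ Shatters 𝓕 S) × length Sh ≡ length 𝓕

VCdim≤1 : ∀ {n} → List (Subset n) → Set
VCdim≤1 𝓕 = ∀ S → Shatters 𝓕 S → ∣ S ∣ ≤ 1

Edge : ∀ {n} → List (Subset n) → Subset n → Subset n → Fin n → Set
Edge 𝓕 G F j = G ∈ 𝓕 × F ∈ 𝓕 × j ∉ₛ G × F ≡ G ∪ ⁅ j ⁆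

Adj : ∀ {n} → List (Subset n) → Subset n → Subset n → Set
Adj 𝓕 G H = ∃ λ j → Edge 𝓕 G H j ⊎ Edge 𝓕 H G j

data Walk {n} (𝓕 : List (Subset n)) : Subset n → Subset n → Set where
  here : ∀ {G} → Walk 𝓕 G G
  step : ∀ {G K H} → Adj 𝓕 G K → Walk 𝓕 K H → Walk 𝓕 G H

Connected : ∀ {n} → List (Subset n) → Set
Connected 𝓕 = ∀ {G H} → G ∈ 𝓕 → H ∈ 𝓕 → Walk 𝓕 G H

-- a cycle: distinct vertices x, v₁, …, v_k (k ≥ 2, so at least 3 vertices),
-- consecutive ones adjacent, and v_k adjacent to x.
record Cycle {n} (𝓕 : List (Subset n)) : Set where
  field
    x      : Subset n
    vs     : List (Subset n)
    long   : length vs ≥ 2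
    inF    : All (_∈ 𝓕) (x ∷ vs)
    dist   : Unique (x ∷ vs)
    closed : Linked (Adj 𝓕) (x ∷ vs ∷ʳ x)

IsTree : ∀ {n} → List (Subset n) → Set
IsTree 𝓕 = (∃ λ G → G ∈ 𝓕) × Connected 𝓕 × (Cycle 𝓕 → ⊥')
  where open import Data.Empty renaming (⊥ to ⊥')

DistinctLabels : ∀ {n} → List (Subset n) → Set
DistinctLabels 𝓕 = ∀ {G₁ F₁ G₂ F₂ j} →
  Edge 𝓕 G₁ F₁ j → Edge 𝓕 G₂ F₂ j → G₁ ≡ G₂ × F₁ ≡ F₂

module Submission where

-- Families are encoded by characteristic functions f and studied by
-- induction on n, splitting f along the first coordinate into two fibres;
-- their union (the shadow) and intersection (the core) satisfy
-- |f| = |shadow f| + |core f|.  A coordinate i splits f if some members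
-- contain i and some do not; let c(f) be the number of such coordinates.
--   (E) distinct labels exclude cycles;
--   (A) if no pair {i, j} is shattered, |f| ≤ 1 + c(f), as the core has
--       at most one member;
--   (C) connected with distinct labels implies that no pair is shattered;
--   (B) a nonempty connected f has |f| ≥ 1 + c(f), as a 0-edge yields a
--       core member;
--   (D) a tight f (|f| = 1 + c(f)) with no shattered pair has distinct
--       labels and is connected.
-- For a nonempty family of VC dimension ≤ 1 the shattered sets are ∅ and
-- the {i} with i splitting, so s-extremality means tightness.  The theorem
-- follows: s-extremal and VC ≤ 1 give tightness, hence (D) and (E); a tree
-- with distinct labels has VC ≤ 1 by (C) and is tight by (A) and (B).

open import Defs

open import Algebra.Bundles using (CommutativeMonoid)
import Algebra.Properties.CommutativeSemigroup as CommutativeSemigroup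
open import Data.Bool using (Bool; true; false; _∨_; _∧_; not; if_then_else_)
import Data.Bool as Bool
open import Data.Bool.Properties
  using (∨-identityʳ; ∨-zeroʳ; ∧-identityʳ; ∧-zeroʳ; ∧-comm; ∧-distribʳ-∨; ¬-not; not-¬;
         ∨-commutativeMonoid)
open import Data.Empty using (⊥; ⊥-elim)
open import Data.Fin using (Fin; zero; suc)
import Data.Fin as Fin
open import Data.Fin.Properties using (suc-injective)
open import Data.Fin.Subset using (Subset; _∪_; _∩_; ⁅_⁆; ∣_∣; _⊆_; _⊂_)
  renaming (⊥ to ∅; _∈_ to _∈ₛ_; _∉_ to _∉ₛ_)
open import Data.Fin.Subset.Properties
  using (∪-identityʳ; ∣⁅x⁆∣≡1; p⊂q⇒∣p∣<∣q∣; p⊆p∪q; x∈p∪q⁺; x∈p∪q⁻;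
         x∈⁅x⁆; x∈⁅y⁆⇒x≡y; ⊥⊆)
open import Data.List using (List; []; _∷_; _++_; _∷ʳ_; length; map)
open import Data.List.Properties using (length-++; length-map)
open import Data.List.Membership.Propositional using (_∈_)
open import Data.List.Membership.Propositional.Properties
  using (∈-++⁺ˡ; ∈-++⁺ʳ; ∈-++⁻; ∈-map⁺; ∈-map⁻)
import Data.List.Membership.DecPropositional as DecMembership
open import Data.List.Relation.Unary.All using ([]; _∷_)
import Data.List.Relation.Unary.All as All
open import Data.List.Relation.Unary.All.Properties using (¬Any⇒All¬; ++⁻ˡ)
open import Data.List.Relation.Unary.AllPairs using ([]; _∷_)
open import Data.List.Relation.Unary.Any using (here; there)
open import Data.List.Relation.Unary.Linked using (Linked; _∷_)
open import Data.List.Relation.Unary.Unique.Propositional using (Unique)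
open import Data.List.Relation.Unary.Unique.Propositional.Properties using (++⁺; map⁺)
open import Data.Nat using (ℕ; zero; suc; _+_; _≤_; _≥_; z≤n; s≤s)
open import Data.Nat.Properties
  using (_≤?_; ≰⇒>; ≤-refl; ≤-reflexive; ≤-trans; ≤-antisym; m≤m+n; m≤n+m;
         +-identityʳ; +-suc; +-comm; +-mono-≤; +-monoʳ-≤; +-cancelˡ-≡; +-cancelʳ-≤;
         +-commutativeSemigroup; module ≤-Reasoning)
open import Data.Product using (Σ; ∃; _×_; _,_; proj₁; proj₂)
open import Data.Sum using (_⊎_; inj₁; inj₂; [_,_]′)
open import Data.Vec using ([]; _∷_; lookup; tail; tabulate)
open import Data.Vec.Base using () renaming (here to at-head; there to in-tail)
open import Data.Vec.Properties
  using (≡-dec; ∷-injectiveˡ; ∷-injectiveʳ; lookup-zipWith; lookup-replicate; lookup⇒[]=;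
         []=⇒lookup; tabulate∘lookup; tabulate-cong; lookup∘tabulate)
open import Function using (_∘_)
open import Function.Bundles using (_⇔_; mk⇔; Equivalence)
open import Function.Construct.Composition using (_⇔-∘_)
open import Relation.Binary.Definitions using (DecidableEquality)
open import Relation.Binary.PropositionalEquality
open import Relation.Nullary using (¬_; yes; no; does)

open CommutativeSemigroup +-commutativeSemigroup using () renaming (interchange to +-interchange)
open CommutativeSemigroup (CommutativeMonoid.commutativeSemigroup ∨-commutativeMonoid)
  using () renaming (interchange to ∨-interchange)

∨-elim : ∀ a {b} → a ∨ b ≡ true → a ≡ true ⊎ b ≡ true
∨-elim true _ = inj₁ refl
∨-elim false b≡true = inj₂ b≡true

∨-introˡ : ∀ {a} b → a ≡ true → a ∨ b ≡ true
∨-introˡ _ refl = refl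

∨-introʳ : ∀ a {b} → b ≡ true → a ∨ b ≡ true
∨-introʳ true _ = refl
∨-introʳ false b≡true = b≡true

∧-elimˡ : ∀ {a b} → a ∧ b ≡ true → a ≡ true
∧-elimˡ {true} _ = refl

∧-elimʳ : ∀ {a b} → a ∧ b ≡ true → b ≡ true
∧-elimʳ {true} b≡true = b≡true

∧-intro : ∀ {a b} → a ≡ true → b ≡ true → a ∧ b ≡ true
∧-intro refl refl = refl

false≢true : ∀ {b} → b ≡ false → b ≡ true → ⊥
false≢true refl ()

bool-cases : (b : Bool) → b ≡ true ⊎ b ≡ false
bool-cases true = inj₁ refl
bool-cases false = inj₂ refl

Family : ℕ → Set
Family n = Subset n → Bool

infix 4 _∋_
_∋_ : ∀ {n} → Family n → Subset n → Set
f ∋ s = f s ≡ true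

_∪ᶠ_ _∩ᶠ_ : ∀ {n} → Family n → Family n → Family n
(f ∪ᶠ g) s = f s ∨ g s
(f ∩ᶠ g) s = f s ∧ g s

fibre : ∀ {n} → Bool → Family (suc n) → Family n
fibre b f s = f (b ∷ s)

shadow core : ∀ {n} → Family (suc n) → Family n
shadow f = fibre false f ∪ᶠ fibre true f
core f = fibre false f ∩ᶠ fibre true f

bit : Bool → ℕ
bit true = 1
bit false = 0

size : ∀ {n} → Family n → ℕ
size {zero} f = bit (f [])
size {suc n} f = size (fibre false f) + size (fibre true f)

inhabited : ∀ {n} → Family n → Bool
inhabited {zero} f = f []
inhabited {suc n} f = inhabited (fibre false f) ∨ inhabited (fibre true f)

bothFibres : ∀ {n} → Family (suc n) → Bool
bothFibres f = inhabited (fibre false f) ∧ inhabited (fibre true f)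

Empty : ∀ {n} → Family n → Set
Empty f = ∀ s → f s ≡ false

size-cong : ∀ {n} {f g : Family n} → (∀ s → f s ≡ g s) → size f ≡ size g
size-cong {zero} f≗g = cong bit (f≗g [])
size-cong {suc n} f≗g =
  cong₂ _+_ (size-cong λ s → f≗g (false ∷ s)) (size-cong λ s → f≗g (true ∷ s))

inhabited-cong : ∀ {n} {f g : Family n} → (∀ s → f s ≡ g s) → inhabited f ≡ inhabited g
inhabited-cong {zero} f≗g = f≗g []
inhabited-cong {suc n} f≗g =
  cong₂ _∨_ (inhabited-cong λ s → f≗g (false ∷ s)) (inhabited-cong λ s → f≗g (true ∷ s))

bit-∨∧ : ∀ a b → bit (a ∨ b) + bit (a ∧ b) ≡ bit a + bit b
bit-∨∧ true true = refl
bit-∨∧ true false = refl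
bit-∨∧ false true = refl
bit-∨∧ false false = refl

size-∪∩ : ∀ {n} (f g : Family n) → size (f ∪ᶠ g) + size (f ∩ᶠ g) ≡ size f + size g
size-∪∩ {zero} f g = bit-∨∧ (f []) (g [])
size-∪∩ {suc n} f g = begin
  (size (f₀ ∪ᶠ g₀) + size (f₁ ∪ᶠ g₁)) + (size (f₀ ∩ᶠ g₀) + size (f₁ ∩ᶠ g₁))
    ≡⟨ +-interchange (size (f₀ ∪ᶠ g₀)) _ _ _ ⟩
  (size (f₀ ∪ᶠ g₀) + size (f₀ ∩ᶠ g₀)) + (size (f₁ ∪ᶠ g₁) + size (f₁ ∩ᶠ g₁))
    ≡⟨ cong₂ _+_ (size-∪∩ f₀ g₀) (size-∪∩ f₁ g₁) ⟩
  (size f₀ + size g₀) + (size f₁ + size g₁)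
    ≡⟨ +-interchange (size f₀) _ _ _ ⟩
  (size f₀ + size f₁) + (size g₀ + size g₁) ∎
  where
  open ≡-Reasoning
  f₀ = fibre false f; f₁ = fibre true f; g₀ = fibre false g; g₁ = fibre true g

size-shadow-core : ∀ {n} (f : Family (suc n)) → size f ≡ size (shadow f) + size (core f)
size-shadow-core f = sym (size-∪∩ (fibre false f) (fibre true f))

inhabited-sound : ∀ {n} (f : Family n) → inhabited f ≡ true → ∃ λ s → f ∋ s
inhabited-sound {zero} f f∋[] = [] , f∋[]
inhabited-sound {suc n} f inh with ∨-elim (inhabited (fibre false f)) inh
... | inj₁ inh₀ = let s , f∋s = inhabited-sound (fibre false f) inh₀ in false ∷ s , f∋s
... | inj₂ inh₁ = let s , f∋s = inhabited-sound (fibre true f) inh₁ in true ∷ s , f∋s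

inhabited-complete : ∀ {n} (f : Family n) s → f ∋ s → inhabited f ≡ true
inhabited-complete {zero} f [] f∋s = f∋s
inhabited-complete {suc n} f (false ∷ s) f∋s =
  ∨-introˡ (inhabited (fibre true f)) (inhabited-complete (fibre false f) s f∋s)
inhabited-complete {suc n} f (true ∷ s) f∋s =
  ∨-introʳ (inhabited (fibre false f)) (inhabited-complete (fibre true f) s f∋s)

uninhabited : ∀ {n} (f : Family n) → inhabited f ≡ false → Empty f
uninhabited f empty s with bool-cases (f s)
... | inj₂ f∌s = f∌s
... | inj₁ f∋s = ⊥-elim (false≢true empty (inhabited-complete f s f∋s))

size-empty : ∀ {n} (f : Family n) → Empty f → size f ≡ 0
size-empty {zero} f empty = cong bit (empty [])
size-empty {suc n} f empty =
  cong₂ _+_ (size-empty (fibre false f) λ s → empty (false ∷ s))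
            (size-empty (fibre true f) λ s → empty (true ∷ s))

fibre-cases : ∀ {n} (f : Family (suc n)) → bothFibres f ≡ true ⊎ ∃ λ b → Empty (fibre (not b) f)
fibre-cases f with bool-cases (inhabited (fibre false f)) | bool-cases (inhabited (fibre true f))
... | inj₁ inh₀ | inj₁ inh₁ = inj₁ (∧-intro inh₀ inh₁)
... | inj₁ _ | inj₂ empty₁ = inj₂ (false , uninhabited _ empty₁)
... | inj₂ empty₀ | _ = inj₂ (true , uninhabited _ empty₀)

one-fibre-size : ∀ {n} (f : Family (suc n)) b → Empty (fibre (not b) f) → size f ≡ size (fibre b f)
one-fibre-size f false empty =
  trans (cong (size (fibre false f) +_) (size-empty (fibre true f) empty)) (+-identityʳ _)
one-fibre-size f true empty = cong (_+ size (fibre true f)) (size-empty (fibre false f) empty)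

size-member : ∀ {n} (f : Family n) s → f ∋ s → 1 ≤ size f
size-member {zero} f [] f∋s = ≤-reflexive (cong bit (sym f∋s))
size-member {suc n} f (false ∷ s) f∋s = ≤-trans (size-member (fibre false f) s f∋s) (m≤m+n _ _)
size-member {suc n} f (true ∷ s) f∋s = ≤-trans (size-member (fibre true f) s f∋s) (m≤n+m _ _)

member-of-size : ∀ {n} (f : Family n) → 1 ≤ size f → ∃ λ s → f ∋ s
member-of-size f 1≤size with bool-cases (inhabited f)
... | inj₁ inh = inhabited-sound f inh
... | inj₂ empty with () ← subst (1 ≤_) (size-empty f (uninhabited f empty)) 1≤size

bit≤1 : ∀ b → bit b ≤ 1
bit≤1 true = ≤-refl
bit≤1 false = z≤n

size≤1 : ∀ {n} (f : Family n) → (∀ s t → f ∋ s → f ∋ t → s ≡ t) → size f ≤ 1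
size≤1 {zero} f _ = bit≤1 (f [])
size≤1 {suc n} f unique with fibre-cases f
... | inj₁ both
  with inhabited-sound (fibre false f) (∧-elimˡ both) | inhabited-sound (fibre true f) (∧-elimʳ both)
...   | s , f∋0s | t , f∋1t with () ← unique (false ∷ s) (true ∷ t) f∋0s f∋1t
size≤1 {suc n} f unique | inj₂ (b , empty) = subst (_≤ 1) (sym (one-fibre-size f b empty))
  (size≤1 (fibre b f) λ s t f∋bs f∋bt → ∷-injectiveʳ (unique (b ∷ s) (b ∷ t) f∋bs f∋bt))

inhabited-∪ : ∀ {n} (f g : Family n) → inhabited (f ∪ᶠ g) ≡ inhabited f ∨ inhabited g
inhabited-∪ {zero} f g = refl
inhabited-∪ {suc n} f g = begin
  inhabited (f₀ ∪ᶠ g₀) ∨ inhabited (f₁ ∪ᶠ g₁)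
    ≡⟨ cong₂ _∨_ (inhabited-∪ f₀ g₀) (inhabited-∪ f₁ g₁) ⟩
  (inhabited f₀ ∨ inhabited g₀) ∨ (inhabited f₁ ∨ inhabited g₁)
    ≡⟨ ∨-interchange (inhabited f₀) _ _ _ ⟩
  (inhabited f₀ ∨ inhabited f₁) ∨ (inhabited g₀ ∨ inhabited g₁) ∎
  where
  open ≡-Reasoning
  f₀ = fibre false f; f₁ = fibre true f; g₀ = fibre false g; g₁ = fibre true g

inhabited-nothing : ∀ {n} → inhabited {n} (λ _ → false) ≡ false
inhabited-nothing {zero} = refl
inhabited-nothing {suc n} = cong₂ _∨_ (inhabited-nothing {n}) (inhabited-nothing {n})

inhabited-shadow : ∀ {n} (f : Family (suc n)) (g : Family n) →
  inhabited (λ s → f s ∧ g (tail s)) ≡ inhabited (shadow f ∩ᶠ g)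
inhabited-shadow f g = begin
  inhabited (fibre false f ∩ᶠ g) ∨ inhabited (fibre true f ∩ᶠ g)
    ≡⟨ inhabited-∪ (fibre false f ∩ᶠ g) (fibre true f ∩ᶠ g) ⟨
  inhabited ((fibre false f ∩ᶠ g) ∪ᶠ (fibre true f ∩ᶠ g))
    ≡⟨ inhabited-cong (λ t → ∧-distribʳ-∨ (g t) (f (false ∷ t)) (f (true ∷ t))) ⟨
  inhabited (shadow f ∩ᶠ g) ∎
  where open ≡-Reasoning

splits : ∀ {n} → Family n → Fin n → Bool
splits f i = inhabited (λ s → f s ∧ lookup s i) ∧ inhabited (λ s → f s ∧ not (lookup s i))

countFin : ∀ {n} → (Fin n → Bool) → ℕ
countFin {zero} p = 0
countFin {suc n} p = bit (p zero) + countFin (λ i → p (suc i))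

splitCount : ∀ {n} → Family n → ℕ
splitCount f = countFin (splits f)

countFin-cong : ∀ {n} {p q : Fin n → Bool} → (∀ i → p i ≡ q i) → countFin p ≡ countFin q
countFin-cong {zero} p≗q = refl
countFin-cong {suc n} p≗q = cong₂ _+_ (cong bit (p≗q zero)) (countFin-cong λ i → p≗q (suc i))

splits-zero : ∀ {n} (f : Family (suc n)) → splits f zero ≡ bothFibres f
splits-zero {n} f = begin
  splits f zero
    ≡⟨ cong₂ _∧_ (cong₂ _∨_ (inhabited-cong (λ t → ∧-zeroʳ (f (false ∷ t))))
                            (inhabited-cong (λ t → ∧-identityʳ (f (true ∷ t)))))
                 (cong₂ _∨_ (inhabited-cong (λ t → ∧-identityʳ (f (false ∷ t))))
                            (inhabited-cong (λ t → ∧-zeroʳ (f (true ∷ t))))) ⟩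
  (nothing ∨ inhabited f₁) ∧ (inhabited f₀ ∨ nothing)
    ≡⟨ cong₂ (λ a b → (a ∨ inhabited f₁) ∧ (inhabited f₀ ∨ b))
             (inhabited-nothing {n}) (inhabited-nothing {n}) ⟩
  inhabited f₁ ∧ (inhabited f₀ ∨ false)
    ≡⟨ cong (inhabited f₁ ∧_) (∨-identityʳ _) ⟩
  inhabited f₁ ∧ inhabited f₀
    ≡⟨ ∧-comm (inhabited f₁) _ ⟩
  bothFibres f ∎
  where
  open ≡-Reasoning
  f₀ = fibre false f; f₁ = fibre true f
  nothing = inhabited {n} (λ _ → false)

splits-suc : ∀ {n} (f : Family (suc n)) i → splits f (suc i) ≡ splits (shadow f) i
splits-suc f i = cong₂ _∧_ (inhabited-shadow f (λ t → lookup t i))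
                           (inhabited-shadow f (λ t → not (lookup t i)))

splitCount-suc : ∀ {n} (f : Family (suc n)) →
  splitCount f ≡ bit (bothFibres f) + splitCount (shadow f)
splitCount-suc f = cong₂ _+_ (cong bit (splits-zero f)) (countFin-cong (splits-suc f))

-- The same recursion, in the shape of 'size-shadow-core'.
1+splitCount-suc : ∀ {n} (f : Family (suc n)) →
  1 + splitCount f ≡ (1 + splitCount (shadow f)) + bit (bothFibres f)
1+splitCount-suc f =
  cong suc (trans (splitCount-suc f) (+-comm (bit (bothFibres f)) (splitCount (shadow f))))

splitCount-cong : ∀ {n} {f g : Family n} → (∀ s → f s ≡ g s) → splitCount f ≡ splitCount g
splitCount-cong f≗g = countFin-cong λ i → cong₂ _∧_
  (inhabited-cong λ s → cong (_∧ lookup s i) (f≗g s))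
  (inhabited-cong λ s → cong (_∧ not (lookup s i)) (f≗g s))

splits-sound : ∀ {n} (f : Family n) i → splits f i ≡ true →
  (∃ λ s → f ∋ s × lookup s i ≡ true) × (∃ λ t → f ∋ t × lookup t i ≡ false)
splits-sound f i split =
  let s , s∈ = inhabited-sound _ (∧-elimˡ split)
      t , t∈ = inhabited-sound _ (∧-elimʳ split)
  in (s , ∧-elimˡ s∈ , ∧-elimʳ s∈) , (t , ∧-elimˡ t∈ , not-true (∧-elimʳ t∈))
  where
  not-true : ∀ {b} → not b ≡ true → b ≡ false
  not-true {false} _ = refl

splits-complete : ∀ {n} (f : Family n) i s t → f ∋ s → lookup s i ≡ true →
  f ∋ t → lookup t i ≡ false → splits f i ≡ true
splits-complete f i s t f∋s i∈s f∋t i∉t = ∧-intro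
  (inhabited-complete _ s (∧-intro f∋s i∈s))
  (inhabited-complete _ t (∧-intro f∋t (cong not i∉t)))

_≟ˢ_ : ∀ {n} → DecidableEquality (Subset n)
_≟ˢ_ = ≡-dec Bool._≟_

subset-ext : ∀ {n} {p q : Subset n} → (∀ i → lookup p i ≡ lookup q i) → p ≡ q
subset-ext {p = p} {q} p≗q =
  trans (sym (tabulate∘lookup p)) (trans (tabulate-cong p≗q) (tabulate∘lookup q))

lookup-∅ : ∀ {n} (i : Fin n) → lookup ∅ i ≡ false
lookup-∅ i = lookup-replicate i false

∉⇒lookup : ∀ {n} {p : Subset n} {i} → i ∉ₛ p → lookup p i ≡ false
∉⇒lookup {p = p} {i} i∉p with bool-cases (lookup p i)
... | inj₁ i∈p = ⊥-elim (i∉p (lookup⇒[]= i p i∈p))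
... | inj₂ i∉p = i∉p

lookup-⁅⁆ : ∀ {n} (i : Fin n) → lookup ⁅ i ⁆ i ≡ true
lookup-⁅⁆ i = []=⇒lookup (x∈⁅x⁆ i)

lookup-⁅⁆-other : ∀ {n} {i j : Fin n} → i ≢ j → lookup ⁅ j ⁆ i ≡ false
lookup-⁅⁆-other {j = j} i≢j = ∉⇒lookup (i≢j ∘ x∈⁅y⁆⇒x≡y j)

added : ∀ {n} {G : Subset n} {j} → j ∉ₛ G → lookup G j ≡ false × lookup (G ∪ ⁅ j ⁆) j ≡ true
added {G = G} {j} j∉G = ∉⇒lookup j∉G , (begin
  lookup (G ∪ ⁅ j ⁆) j    ≡⟨ lookup-zipWith _∨_ j G ⁅ j ⁆ ⟩
  lookup G j ∨ lookup ⁅ j ⁆ j ≡⟨ cong (lookup G j ∨_) (lookup-⁅⁆ j) ⟩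
  lookup G j ∨ true       ≡⟨ ∨-zeroʳ _ ⟩
  true                    ∎)
  where open ≡-Reasoning

kept : ∀ {n} (G : Subset n) {j k} → k ≢ j → lookup (G ∪ ⁅ j ⁆) k ≡ lookup G k
kept G {j} {k} k≢j = begin
  lookup (G ∪ ⁅ j ⁆) k        ≡⟨ lookup-zipWith _∨_ k G ⁅ j ⁆ ⟩
  lookup G k ∨ lookup ⁅ j ⁆ k ≡⟨ cong (lookup G k ∨_) (lookup-⁅⁆-other k≢j) ⟩
  lookup G k ∨ false          ≡⟨ ∨-identityʳ _ ⟩
  lookup G k                  ∎
  where open ≡-Reasoning

-- The inclusion graph of Defs, for a family given by a membership
-- predicate M (Defs uses M = _∈ 𝓕; the definitions then coincide).
module _ {n} (M : Subset n → Set) where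

  Edge′ : Subset n → Subset n → Fin n → Set
  Edge′ G F j = M G × M F × j ∉ₛ G × F ≡ G ∪ ⁅ j ⁆

  Link : Subset n → Subset n → Fin n → Set
  Link A B j = Edge′ A B j ⊎ Edge′ B A j

  Adj′ : Subset n → Subset n → Set
  Adj′ G H = ∃ λ j → Link G H j

  data Walk′ : Subset n → Subset n → Set where
    stay : ∀ {G} → Walk′ G G
    move : ∀ {G K H} → Adj′ G K → Walk′ K H → Walk′ G H

  Connected′ : Set
  Connected′ = ∀ {G H} → M G → M H → Walk′ G H

  DistinctLabels′ : Set
  DistinctLabels′ = ∀ {G₁ F₁ G₂ F₂ j} → Edge′ G₁ F₁ j → Edge′ G₂ F₂ j → G₁ ≡ G₂ × F₁ ≡ F₂

module _ {n} {M : Subset n → Set} where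

  vertices : ∀ {G H} → Walk′ M G H → List (Subset n)
  vertices {G} stay = G ∷ []
  vertices {G} (move _ w) = G ∷ vertices w

  start∈ : ∀ {G H} (w : Walk′ M G H) → G ∈ vertices w
  start∈ stay = here refl
  start∈ (move _ w) = here refl

  end∈ : ∀ {G H} (w : Walk′ M G H) → H ∈ vertices w
  end∈ stay = here refl
  end∈ (move _ w) = there (end∈ w)

  _++ᵂ_ : ∀ {G K H} → Walk′ M G K → Walk′ M K H → Walk′ M G H
  stay ++ᵂ v = v
  move a w ++ᵂ v = move a (w ++ᵂ v)

  link-flips : ∀ {A B j} → Link M A B j → lookup A j ≢ lookup B j
  link-flips (inj₁ (_ , _ , j∉A , refl)) Aj≡Bj =
    false≢true (proj₁ (added j∉A)) (trans Aj≡Bj (proj₂ (added j∉A)))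
  link-flips (inj₂ (_ , _ , j∉B , refl)) Aj≡Bj =
    false≢true (proj₁ (added j∉B)) (trans (sym Aj≡Bj) (proj₂ (added j∉B)))

  link-keeps : ∀ {A B j k} → k ≢ j → Link M A B j → lookup A k ≡ lookup B k
  link-keeps {A} k≢j (inj₁ (_ , _ , _ , refl)) = sym (kept A k≢j)
  link-keeps {B = B} k≢j (inj₂ (_ , _ , _ , refl)) = kept B k≢j

  link-label : ∀ {G K} j → Adj′ M G K → lookup G j ≢ lookup K j → Link M G K j
  link-label j (k , link) Gj≢Kj with k Fin.≟ j
  ... | yes refl = link
  ... | no k≢j = ⊥-elim (Gj≢Kj (link-keeps (k≢j ∘ sym) link))

  record Crossing (j : Fin n) {G H} (w : Walk′ M G H) : Set where
    field
      {from to} : Subset n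
      link      : Link M from to j
      before    : Walk′ M G from
      after     : Walk′ M to H
      splitting : vertices w ≡ vertices before ++ vertices after

    from∈before : from ∈ vertices before
    from∈before = end∈ before

    to∈after : to ∈ vertices after
    to∈after = start∈ after

    from∈ : from ∈ vertices w
    from∈ = subst (from ∈_) (sym splitting) (∈-++⁺ˡ from∈before)

    to∈ : to ∈ vertices w
    to∈ = subst (to ∈_) (sym splitting) (∈-++⁺ʳ (vertices before) to∈after)

  crossing : ∀ {G H} j (w : Walk′ M G H) → lookup G j ≢ lookup H j → Crossing j w
  crossing j stay Gj≢Hj = ⊥-elim (Gj≢Hj refl)
  crossing {G} j (move {K = K} a w) Gj≢Hj with lookup G j Bool.≟ lookup K j
  ... | no Gj≢Kj = record
    { link = link-label j a Gj≢Kj ; before = stay ; after = w ; splitting = refl }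
  ... | yes Gj≡Kj = record
    { link = Crossing.link rest
    ; before = move a (Crossing.before rest)
    ; after = Crossing.after rest
    ; splitting = cong (G ∷_) (Crossing.splitting rest) }
    where rest = crossing j w (Gj≢Hj ∘ trans Gj≡Kj)

  Path : Subset n → Subset n → Set
  Path G H = Σ (Walk′ M G H) λ w → Unique (vertices w)

  private
    suffix : ∀ {G K H} (w : Walk′ M K H) → G ∈ vertices w →
      Σ (Walk′ M G H) λ w′ → Unique (vertices w) → Unique (vertices w′)
    suffix stay (here refl) = stay , λ u → u
    suffix (move a w) (here refl) = move a w , λ u → u
    suffix (move a w) (there G∈w) =
      let w′ , shrink = suffix w G∈w in w′ , λ { (_ ∷ u) → shrink u }

  shortcut : ∀ {G H} → Walk′ M G H → Path G H
  shortcut stay = stay , [] ∷ []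
  shortcut {G} (move a w) with shortcut w
  ... | p , unique-p with DecMembership._∈?_ _≟ˢ_ G (vertices p)
  ...   | yes G∈p = let p′ , shrink = suffix p G∈p in p′ , shrink unique-p
  ...   | no G∉p = move a p , ¬Any⇒All¬ (vertices p) G∉p ∷ unique-p

  same-link : DistinctLabels′ M → ∀ {A B C D j} → Link M A B j → Link M C D j →
    (C ≡ A × D ≡ B) ⊎ (C ≡ B × D ≡ A)
  same-link distinct (inj₁ e₁) (inj₁ e₂) = let G , F = distinct e₁ e₂ in inj₁ (sym G , sym F)
  same-link distinct (inj₁ e₁) (inj₂ e₂) = let G , F = distinct e₁ e₂ in inj₂ (sym F , sym G)
  same-link distinct (inj₂ e₁) (inj₁ e₂) = let G , F = distinct e₁ e₂ in inj₂ (sym G , sym F)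
  same-link distinct (inj₂ e₁) (inj₂ e₂) = let G , F = distinct e₁ e₂ in inj₁ (sym F , sym G)

module _ {A : Set} where

  unique-disjoint : ∀ (xs : List A) {ys a} → Unique (xs ++ ys) → a ∈ xs → a ∈ ys → ⊥
  unique-disjoint (x ∷ xs) (x∉ ∷ _) (here refl) a∈ys = All.lookup x∉ (∈-++⁺ʳ xs a∈ys) refl
  unique-disjoint (x ∷ xs) (_ ∷ u) (there a∈xs) a∈ys = unique-disjoint xs u a∈xs a∈ys

  unique-++ˡ : ∀ (xs : List A) {ys} → Unique (xs ++ ys) → Unique xs
  unique-++ˡ [] _ = []
  unique-++ˡ (x ∷ xs) (x∉ ∷ u) = ++⁻ˡ xs x∉ ∷ unique-++ˡ xs u

  unique-++ʳ : ∀ (xs : List A) {ys} → Unique (xs ++ ys) → Unique ys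
  unique-++ʳ [] u = u
  unique-++ʳ (x ∷ xs) (_ ∷ u) = unique-++ʳ xs u

  unique-rotate : ∀ {x : A} {vs} → Unique (x ∷ vs) → Unique (vs ∷ʳ x)
  unique-rotate (x∉ ∷ u) = ++⁺ u ([] ∷ []) λ { (x∈vs , here refl) → All.lookup x∉ x∈vs refl }

module _ {n} {M : Subset n → Set} where

  linked⇒walk : ∀ y zs x → Linked (Adj′ M) (y ∷ zs ∷ʳ x) →
    Σ (Walk′ M y x) λ w → vertices w ≡ y ∷ zs ∷ʳ x
  linked⇒walk y [] x (a ∷ _) = move a stay , refl
  linked⇒walk y (z ∷ zs) x (a ∷ chain) =
    let w , vw = linked⇒walk z zs x chain in move a w , cong (y ∷_) vw

  closed-path : ∀ {G H} (w : Walk′ M G H) → Unique (vertices w) → G ≡ H →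
    length (vertices w) ≡ 1
  closed-path stay _ _ = refl
  closed-path (move _ w) (G∉ ∷ _) refl = ⊥-elim (All.lookup G∉ (end∈ w) refl)

-- Let x, v₁, …, v_k, x be a cycle whose
-- first edge x—v₁ has label j.  The path v₁ → … → x crosses a j-edge,
-- which by distinctness is the edge x—v₁ itself: either x occurs twice
-- on the path, or the path is just v₁, x, contradicting k ≥ 2.
distinctLabels⇒acyclic : ∀ {n} (𝓕 : List (Subset n)) → DistinctLabels 𝓕 → Cycle 𝓕 → ⊥
distinctLabels⇒acyclic 𝓕 distinct record { x = x ; vs = vs ; long = long ; dist = dist ; closed = closed }
  = go vs long dist closed
  where
  go : ∀ vs → length vs ≥ 2 → Unique (x ∷ vs) → Linked (Adj 𝓕) (x ∷ vs ∷ʳ x) → ⊥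
  go [] () _ _
  go (_ ∷ []) (s≤s ()) _ _
  go (v₁ ∷ v₂ ∷ rest) _ unique ((j , first) ∷ chain) = through-first (same-link distinct first link)
    where
    walk = linked⇒walk v₁ (v₂ ∷ rest) x chain
    open Crossing (crossing j (proj₁ walk) (link-flips first ∘ sym))
    vertices≡ : v₁ ∷ v₂ ∷ rest ∷ʳ x ≡ vertices before ++ vertices after
    vertices≡ = trans (sym (proj₂ walk)) splitting
    path-unique : Unique (vertices before ++ vertices after)
    path-unique = subst Unique vertices≡ (unique-rotate unique)
    through-first : (from ≡ x × to ≡ v₁) ⊎ (from ≡ v₁ × to ≡ x) → ⊥
    through-first (inj₁ (from≡x , _)) =
      unique-disjoint (vertices before) path-unique
        (subst (_∈ vertices before) from≡x from∈before) (end∈ after)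
    through-first (inj₂ (from≡v₁ , to≡x)) = too-long rest (begin
      length (v₁ ∷ v₂ ∷ rest ∷ʳ x)                       ≡⟨ cong length vertices≡ ⟩
      length (vertices before ++ vertices after)         ≡⟨ length-++ (vertices before) ⟩
      length (vertices before) + length (vertices after)
        ≡⟨ cong₂ _+_ (closed-path before (unique-++ˡ (vertices before) path-unique) (sym from≡v₁))
                     (closed-path after (unique-++ʳ (vertices before) path-unique) to≡x) ⟩
      2                                                  ∎)
      where
      open ≡-Reasoning
      too-long : ∀ rest → length (v₁ ∷ v₂ ∷ rest ∷ʳ x) ≢ 2
      too-long [] ()
      too-long (_ ∷ _) ()

ShattersPair : ∀ {n} → (Subset n → Set) → Fin n → Fin n → Set
ShattersPair M i j = ∀ b c → ∃ λ s → M s × lookup s i ≡ b × lookup s j ≡ c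

NoShatteredPair : ∀ {n} → (Subset n → Set) → Set
NoShatteredPair M = ∀ i j → i ≢ j → ¬ ShattersPair M i j

noPair-fibre : ∀ {n} (f : Family (suc n)) b → NoShatteredPair (f ∋_) → NoShatteredPair (fibre b f ∋_)
noPair-fibre f b noPair i j i≢j shattered = noPair (suc i) (suc j) (i≢j ∘ suc-injective) λ c d →
  let s , f∋s , si , sj = shattered c d in b ∷ s , f∋s , si , sj

noPair-shadow : ∀ {n} (f : Family (suc n)) → NoShatteredPair (f ∋_) → NoShatteredPair (shadow f ∋_)
noPair-shadow f noPair i j i≢j shattered = noPair (suc i) (suc j) (i≢j ∘ suc-injective) lifted
  where
  lifted : ShattersPair (f ∋_) (suc i) (suc j)
  lifted c d with shattered c d
  ... | s , in-shadow , si , sj with ∨-elim (f (false ∷ s)) in-shadow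
  ...   | inj₁ f∋0s = false ∷ s , f∋0s , si , sj
  ...   | inj₂ f∋1s = true ∷ s , f∋1s , si , sj

differ-at : ∀ {n} (s t : Subset n) → s ≢ t → ∃ λ i → lookup t i ≡ not (lookup s i)
differ-at [] [] s≢t = ⊥-elim (s≢t refl)
differ-at (a ∷ s) (b ∷ t) s≢t with a Bool.≟ b
... | no a≢b = zero , ¬-not (a≢b ∘ sym)
... | yes refl = let i , differ = differ-at s t (s≢t ∘ cong (a ∷_)) in suc i , differ

one-of : ∀ x {y} → y ≡ not x → ∀ c → c ≡ x ⊎ c ≡ y
one-of true refl true = inj₁ refl
one-of true refl false = inj₂ refl
one-of false refl true = inj₂ refl
one-of false refl false = inj₁ refl

core⇒member : ∀ {n} (f : Family (suc n)) s b → core f ∋ s → f ∋ (b ∷ s)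
core⇒member f s false in-core = ∧-elimˡ in-core
core⇒member f s true in-core = ∧-elimʳ in-core

-- Without shattered pairs the core has at most one member: two members
-- s ≠ t of the core, differing in coordinate i, would shatter {0, i+1}.
core-unique : ∀ {n} (f : Family (suc n)) → NoShatteredPair (f ∋_) →
  ∀ s t → core f ∋ s → core f ∋ t → s ≡ t
core-unique f noPair s t s∈ t∈ with s ≟ˢ t
... | yes s≡t = s≡t
... | no s≢t with differ-at s t s≢t
...   | i , differ = ⊥-elim (noPair zero (suc i) (λ ()) shattered)
  where
  shattered : ShattersPair (f ∋_) zero (suc i)
  shattered b c with one-of (lookup s i) differ c
  ... | inj₁ c≡si = b ∷ s , core⇒member f s b s∈ , refl , sym c≡si
  ... | inj₂ c≡ti = b ∷ t , core⇒member f t b t∈ , refl , sym c≡ti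

size-core : ∀ {n} (f : Family (suc n)) → NoShatteredPair (f ∋_) → size (core f) ≤ bit (bothFibres f)
size-core f noPair with bool-cases (bothFibres f)
... | inj₁ both rewrite both = size≤1 (core f) (core-unique f noPair)
... | inj₂ notBoth rewrite notBoth = ≤-reflexive (size-empty (core f) core-empty)
  where
  core-empty : ∀ s → core f s ≡ false
  core-empty s with bool-cases (core f s)
  ... | inj₂ s∉ = s∉
  ... | inj₁ s∈ = ⊥-elim (false≢true notBoth (∧-intro
    (inhabited-complete (fibre false f) s (∧-elimˡ s∈))
    (inhabited-complete (fibre true f) s (∧-elimʳ s∈))))

-- By induction on n:
-- |f| = |shadow f| + |core f|, the shadow is handled by induction and
-- the core has at most one member, and only if coordinate 0 splits f.
size≤1+splitCount : ∀ {n} (f : Family n) → NoShatteredPair (f ∋_) → size f ≤ 1 + splitCount f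
size≤1+splitCount {zero} f _ = bit≤1 (f [])
size≤1+splitCount {suc n} f noPair = begin
  size f                                        ≡⟨ size-shadow-core f ⟩
  size (shadow f) + size (core f)
    ≤⟨ +-mono-≤ (size≤1+splitCount (shadow f) (noPair-shadow f noPair)) (size-core f noPair) ⟩
  (1 + splitCount (shadow f)) + bit (bothFibres f) ≡⟨ 1+splitCount-suc f ⟨
  1 + splitCount f                              ∎
  where open ≤-Reasoning

module _ {n} {M : Subset n → Set} where

  shared-vertex : DistinctLabels′ M → ∀ {j G₁ H₁ G₂ H₂} {w₁ : Walk′ M G₁ H₁} {w₂ : Walk′ M G₂ H₂} →
    Crossing j w₁ → Crossing j w₂ → ∃ λ V → V ∈ vertices w₁ × V ∈ vertices w₂
  shared-vertex distinct {w₁ = w₁} c₁ c₂ with same-link distinct (Crossing.link c₁) (Crossing.link c₂)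
  ... | inj₁ (from₂≡from₁ , _) =
    _ , subst (_∈ vertices w₁) (sym from₂≡from₁) (Crossing.from∈ c₁) , Crossing.from∈ c₂
  ... | inj₂ (from₂≡to₁ , _) =
    _ , subst (_∈ vertices w₁) (sym from₂≡to₁) (Crossing.to∈ c₁) , Crossing.from∈ c₂

  -- All i-edges coincide, so their endpoints share one value b at j.
  -- A path from a member with (i, j) ↦ (0, ¬b) to one with (1, ¬b)
  -- crosses this i-edge; both parts of the path, before and after it,
  -- must then cross a j-edge, i.e. the same edge, so the path repeats a vertex.
  connected⇒noPair : Connected′ M → DistinctLabels′ M → NoShatteredPair M
  connected⇒noPair connected distinct i j i≢j shattered =
    let Y₀ , MY₀ , Y₀i , Y₀j = shattered false (not b)
        Y₁ , MY₁ , Y₁i , Y₁j = shattered true (not b)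
    in repeats MY₀ MY₁ Y₀i Y₁i Y₀j Y₁j
    where
    some-i-edge : ∃ λ A → ∃ λ B → Link M A B i
    some-i-edge =
      let s , Ms , si , _ = shattered false false
          t , Mt , ti , _ = shattered true false
          c = crossing i (connected Ms Mt) λ si≡ti → false≢true si (trans si≡ti ti)
      in _ , _ , Crossing.link c
    b = lookup (proj₁ some-i-edge) j

    at-b : ∀ {A B} → Link M A B i → lookup A j ≡ b × lookup B j ≡ b
    at-b link with same-link distinct (proj₂ (proj₂ some-i-edge)) link
                 | link-keeps {M = M} (i≢j ∘ sym) (proj₂ (proj₂ some-i-edge))
                 | link-keeps {M = M} (i≢j ∘ sym) link
    ... | inj₁ (refl , refl) | _ | A≡B = refl , sym A≡B
    ... | inj₂ (refl , refl) | F≡T | A≡B = sym F≡T , trans (sym A≡B) (sym F≡T)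

    repeats : ∀ {Y₀ Y₁} → M Y₀ → M Y₁ → lookup Y₀ i ≡ false → lookup Y₁ i ≡ true →
      lookup Y₀ j ≡ not b → lookup Y₁ j ≡ not b → ⊥
    repeats MY₀ MY₁ Y₀i Y₁i Y₀j Y₁j =
      let V , V∈before , V∈after = shared-vertex distinct cross-before cross-after
      in unique-disjoint (vertices before) (subst Unique splitting (proj₂ path)) V∈before V∈after
      where
      path = shortcut (connected MY₀ MY₁)
      open Crossing (crossing i (proj₁ path) λ eq → false≢true Y₀i (trans eq Y₁i))
      cross-before = crossing j before λ eq →
        not-¬ refl (trans (sym (proj₁ (at-b link))) (trans (sym eq) Y₀j))
      cross-after = crossing j after λ eq →
        not-¬ refl (trans (sym (proj₂ (at-b link))) (trans eq Y₁j))

module _ {n} (f : Family (suc n)) where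

  edge-zero : ∀ {b c g k} → Edge′ (f ∋_) (b ∷ g) (c ∷ k) zero → b ≡ false × c ≡ true × k ≡ g
  edge-zero {true} (_ , _ , 0∉ , _) = ⊥-elim (0∉ at-head)
  edge-zero {false} {g = g} (_ , _ , _ , eq) =
    refl , ∷-injectiveˡ eq , trans (∷-injectiveʳ eq) (∪-identityʳ g)

  edge-zero⇒core : ∀ {A B} → Edge′ (f ∋_) A B zero → core f ∋ tail A
  edge-zero⇒core {_ ∷ _} {_ ∷ _} e@(f∋A , f∋B , _) with edge-zero e
  ... | refl , refl , refl = ∧-intro f∋A f∋B

  core⇒edge-zero : ∀ {g} → core f ∋ g → Edge′ (f ∋_) (false ∷ g) (true ∷ g) zero
  core⇒edge-zero {g} in-core =
    ∧-elimˡ in-core , ∧-elimʳ in-core , (λ ()) , cong (true ∷_) (sym (∪-identityʳ g))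

  edge-suc : ∀ {b c g k i} → Edge′ (f ∋_) (b ∷ g) (c ∷ k) (suc i) →
    c ≡ b × i ∉ₛ g × k ≡ g ∪ ⁅ i ⁆
  edge-suc {b} (_ , _ , i+1∉ , eq) =
    trans (∷-injectiveˡ eq) (∨-identityʳ b) , i+1∉ ∘ in-tail , ∷-injectiveʳ eq

  member⇒shadow : ∀ b {g} → f ∋ (b ∷ g) → shadow f ∋ g
  member⇒shadow false {g} f∋0g = ∨-introˡ (f (true ∷ g)) f∋0g
  member⇒shadow true {g} f∋1g = ∨-introʳ (f (false ∷ g)) f∋1g

  shadow⇒member : ∀ {g} → shadow f ∋ g → ∃ λ b → f ∋ (b ∷ g)
  shadow⇒member {g} in-shadow with ∨-elim (f (false ∷ g)) in-shadow
  ... | inj₁ f∋0g = false , f∋0g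
  ... | inj₂ f∋1g = true , f∋1g

  edge-suc⇒shadow : ∀ {b c g k i} → Edge′ (f ∋_) (b ∷ g) (c ∷ k) (suc i) → Edge′ (shadow f ∋_) g k i
  edge-suc⇒shadow {b} {c} e@(f∋A , f∋B , _) =
    let _ , i∉g , k≡ = edge-suc e in member⇒shadow b f∋A , member⇒shadow c f∋B , i∉g , k≡

  fibre⇒edge-suc : ∀ b {g k i} → Edge′ (fibre b f ∋_) g k i → Edge′ (f ∋_) (b ∷ g) (b ∷ k) (suc i)
  fibre⇒edge-suc b (f∋bg , f∋bk , i∉g , k≡) =
    f∋bg , f∋bk , (λ { (in-tail i∈g) → i∉g i∈g }) , cong₂ _∷_ (sym (∨-identityʳ b)) k≡

  shadow-walk : ∀ {G H} → Walk′ (f ∋_) G H → Walk′ (shadow f ∋_) (tail G) (tail H)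
  shadow-walk stay = stay
  shadow-walk (move {_ ∷ _} {_ ∷ _} (zero , inj₁ e) w) with edge-zero e
  ... | refl , refl , refl = shadow-walk w
  shadow-walk (move {_ ∷ _} {_ ∷ _} (zero , inj₂ e) w) with edge-zero e
  ... | refl , refl , refl = shadow-walk w
  shadow-walk (move {_ ∷ _} {_ ∷ _} (suc i , inj₁ e) w) =
    move (i , inj₁ (edge-suc⇒shadow e)) (shadow-walk w)
  shadow-walk (move {_ ∷ _} {_ ∷ _} (suc i , inj₂ e) w) =
    move (i , inj₂ (edge-suc⇒shadow e)) (shadow-walk w)

  shadow-connected : Connected′ (f ∋_) → Connected′ (shadow f ∋_)
  shadow-connected connected in-G in-H =
    shadow-walk (connected (proj₂ (shadow⇒member in-G)) (proj₂ (shadow⇒member in-H)))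

  fibre-walk : ∀ b {g h} → Walk′ (fibre b f ∋_) g h → Walk′ (f ∋_) (b ∷ g) (b ∷ h)
  fibre-walk b stay = stay
  fibre-walk b (move (i , inj₁ e) w) = move (suc i , inj₁ (fibre⇒edge-suc b e)) (fibre-walk b w)
  fibre-walk b (move (i , inj₂ e) w) = move (suc i , inj₂ (fibre⇒edge-suc b e)) (fibre-walk b w)

-- In a connected family whose two fibres are inhabited, some walk
-- between them crosses an edge labelled 0, so the core is inhabited.
connected⇒core : ∀ {n} (f : Family (suc n)) → Connected′ (f ∋_) → bothFibres f ≡ true →
  1 ≤ size (core f)
connected⇒core f connected both
  with inhabited-sound (fibre false f) (∧-elimˡ both) | inhabited-sound (fibre true f) (∧-elimʳ both)
... | s₀ , f∋0s₀ | s₁ , f∋1s₁ with Crossing.link (crossing zero (connected f∋0s₀ f∋1s₁) λ ())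
...   | inj₁ e = size-member (core f) _ (edge-zero⇒core f e)
...   | inj₂ e = size-member (core f) _ (edge-zero⇒core f e)

connected⇒1+splitCount≤size : ∀ {n} (f : Family n) → Connected′ (f ∋_) →
  (∃ λ s → f ∋ s) → 1 + splitCount f ≤ size f
connected⇒1+splitCount≤size {zero} f _ ([] , f∋[]) = ≤-reflexive (cong bit (sym f∋[]))
connected⇒1+splitCount≤size {suc n} f connected (b ∷ s , f∋bs) = begin
  1 + splitCount f                                 ≡⟨ 1+splitCount-suc f ⟩
  (1 + splitCount (shadow f)) + bit (bothFibres f)
    ≤⟨ +-mono-≤ (connected⇒1+splitCount≤size (shadow f) (shadow-connected f connected)
                   (s , member⇒shadow f b f∋bs))
                core-bound ⟩
  size (shadow f) + size (core f)                  ≡⟨ size-shadow-core f ⟨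
  size f                                           ∎
  where
  open ≤-Reasoning
  core-bound : bit (bothFibres f) ≤ size (core f)
  core-bound with bool-cases (bothFibres f)
  ... | inj₁ both rewrite both = connected⇒core f connected both
  ... | inj₂ notBoth rewrite notBoth = z≤n

-- f attains the upper bound 'size≤1+splitCount'.
Tight : ∀ {n} → Family n → Set
Tight f = size f ≡ 1 + splitCount f

squeeze : ∀ {a b c d} → a + b ≡ c + d → a ≤ c → b ≤ d → a ≡ c × b ≡ d
squeeze {a} {b} {c} {d} sum a≤c b≤d = a≡c , +-cancelˡ-≡ a b d (trans sum (cong (_+ d) (sym a≡c)))
  where
  c≤a : c ≤ a
  c≤a = +-cancelʳ-≤ d c a (subst (_≤ a + d) sum (+-monoʳ-≤ a b≤d))
  a≡c = ≤-antisym a≤c c≤a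

tight-shadow-core : ∀ {n} (f : Family (suc n)) → NoShatteredPair (f ∋_) → Tight f →
  Tight (shadow f) × size (core f) ≡ bit (bothFibres f)
tight-shadow-core f noPair tight =
  squeeze sizes (size≤1+splitCount (shadow f) (noPair-shadow f noPair)) (size-core f noPair)
  where
  sizes : size (shadow f) + size (core f) ≡ (1 + splitCount (shadow f)) + bit (bothFibres f)
  sizes = trans (sym (size-shadow-core f)) (trans tight (1+splitCount-suc f))

-- Two
-- 0-edges both come from the (at most one) core member.  Two (i+1)-edges
-- project to the same i-edge of the shadow, by induction; if they lay in
-- different fibres they would shatter {0, i+1}.
tight⇒distinctLabels : ∀ {n} (f : Family n) → NoShatteredPair (f ∋_) → Tight f →
  DistinctLabels′ (f ∋_)
tight⇒distinctLabels {zero} _ _ _ {j = ()}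
tight⇒distinctLabels {suc n} f noPair tight {_ ∷ g₁} {_ ∷ _} {_ ∷ g₂} {_ ∷ _} {zero} e₁ e₂
  with edge-zero f e₁ | edge-zero f e₂
... | refl , refl , refl | refl , refl , refl
  with refl ← core-unique f noPair g₁ g₂ (edge-zero⇒core f e₁) (edge-zero⇒core f e₂) = refl , refl
tight⇒distinctLabels {suc n} f noPair tight {b₁ ∷ g} {_ ∷ _} {b₂ ∷ _} {_ ∷ _} {suc i} e₁ e₂
  with edge-suc f e₁ | edge-suc f e₂
... | refl , i∉g , refl | refl , _ , refl
  with refl , refl ← tight⇒distinctLabels (shadow f) (noPair-shadow f noPair)
                       (proj₁ (tight-shadow-core f noPair tight))
                       (edge-suc⇒shadow f e₁) (edge-suc⇒shadow f e₂)
  with b₁ Bool.≟ b₂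
... | yes refl = refl , refl
... | no b₁≢b₂ = ⊥-elim (noPair zero (suc i) (λ ()) shattered)
  where
  i-values : lookup g i ≡ false × lookup (g ∪ ⁅ i ⁆) i ≡ true
  i-values = added i∉g
  shattered : ShattersPair (f ∋_) zero (suc i)
  shattered b false with one-of b₁ (¬-not (b₁≢b₂ ∘ sym)) b
  ... | inj₁ refl = b₁ ∷ g , proj₁ e₁ , refl , proj₁ i-values
  ... | inj₂ refl = b₂ ∷ g , proj₁ e₂ , refl , proj₁ i-values
  shattered b true with one-of b₁ (¬-not (b₁≢b₂ ∘ sym)) b
  ... | inj₁ refl = b₁ ∷ (g ∪ ⁅ i ⁆) , proj₁ (proj₂ e₁) , refl , proj₂ i-values
  ... | inj₂ refl = b₂ ∷ (g ∪ ⁅ i ⁆) , proj₁ (proj₂ e₂) , refl , proj₂ i-values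

countFin-disjoint : ∀ {n} (p q : Fin n → Bool) → (∀ i → p i ∧ q i ≡ false) →
  countFin (λ i → p i ∨ q i) ≡ countFin p + countFin q
countFin-disjoint {zero} p q _ = refl
countFin-disjoint {suc n} p q disjoint = begin
  bit (p zero ∨ q zero) + countFin (λ i → p (suc i) ∨ q (suc i))
    ≡⟨ cong₂ _+_ (bit-disjoint (p zero) (q zero) (disjoint zero))
                 (countFin-disjoint (λ i → p (suc i)) (λ i → q (suc i)) (λ i → disjoint (suc i))) ⟩
  (bit (p zero) + bit (q zero)) + (countFin (λ i → p (suc i)) + countFin (λ i → q (suc i)))
    ≡⟨ +-interchange (bit (p zero)) _ _ _ ⟩
  countFin p + countFin q ∎
  where
  open ≡-Reasoning
  bit-disjoint : ∀ a b → a ∧ b ≡ false → bit (a ∨ b) ≡ bit a + bit b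
  bit-disjoint true false _ = refl
  bit-disjoint false b _ = refl

module _ {n} (f : Family (suc n)) where

  private
    f₀ f₁ : Family n
    f₀ = fibre false f
    f₁ = fibre true f

  -- Given a core member a, coordinate i splits the shadow iff it splits
  -- one of the fibres: a supplies the missing value of i in both fibres.
  splits-shadow : ∀ {a} → core f ∋ a → ∀ i → splits (shadow f) i ≡ splits f₀ i ∨ splits f₁ i
  splits-shadow {a} a∈core i = begin
    splits (shadow f) i
      ≡⟨ cong₂ _∧_ (meets (λ s → lookup s i)) (meets (λ s → not (lookup s i))) ⟩
    (has₀ ∨ has₁) ∧ (lacks₀ ∨ lacks₁)
      ≡⟨ by-value (bool-cases (lookup a i)) ⟩
    (has₀ ∧ lacks₀) ∨ (has₁ ∧ lacks₁) ∎
    where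
    open ≡-Reasoning
    meets : ∀ (g : Family n) → inhabited (shadow f ∩ᶠ g) ≡ inhabited (f₀ ∩ᶠ g) ∨ inhabited (f₁ ∩ᶠ g)
    meets g = trans (inhabited-cong λ s → ∧-distribʳ-∨ (g s) (f₀ s) (f₁ s))
                    (inhabited-∪ (f₀ ∩ᶠ g) (f₁ ∩ᶠ g))
    has₀ = inhabited (λ s → f₀ s ∧ lookup s i)
    has₁ = inhabited (λ s → f₁ s ∧ lookup s i)
    lacks₀ = inhabited (λ s → f₀ s ∧ not (lookup s i))
    lacks₁ = inhabited (λ s → f₁ s ∧ not (lookup s i))
    a∈f₀ = ∧-elimˡ a∈core
    a∈f₁ = ∧-elimʳ a∈core
    by-value : lookup a i ≡ true ⊎ lookup a i ≡ false →
      (has₀ ∨ has₁) ∧ (lacks₀ ∨ lacks₁) ≡ (has₀ ∧ lacks₀) ∨ (has₁ ∧ lacks₁)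
    by-value (inj₁ i∈a)
      rewrite inhabited-complete (λ s → f₀ s ∧ lookup s i) a (∧-intro a∈f₀ i∈a)
            | inhabited-complete (λ s → f₁ s ∧ lookup s i) a (∧-intro a∈f₁ i∈a) = refl
    by-value (inj₂ i∉a)
      rewrite inhabited-complete (λ s → f₀ s ∧ not (lookup s i)) a (∧-intro a∈f₀ (cong not i∉a))
            | inhabited-complete (λ s → f₁ s ∧ not (lookup s i)) a (∧-intro a∈f₁ (cong not i∉a))
      = trans (∧-identityʳ (has₀ ∨ has₁))
              (cong₂ _∨_ (sym (∧-identityʳ has₀)) (sym (∧-identityʳ has₁)))

  -- Without shattered pairs no coordinate splits both fibres: that would
  -- shatter {0, i+1}.
  splits-exclusive : NoShatteredPair (f ∋_) → ∀ i → splits f₀ i ∧ splits f₁ i ≡ false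
  splits-exclusive noPair i with bool-cases (splits f₀ i ∧ splits f₁ i)
  ... | inj₂ neither = neither
  ... | inj₁ both = ⊥-elim (noPair zero (suc i) (λ ()) shattered)
    where
    split₀ = splits-sound f₀ i (∧-elimˡ both)
    split₁ = splits-sound f₁ i (∧-elimʳ {splits f₀ i} both)
    shattered : ShattersPair (f ∋_) zero (suc i)
    shattered false true = let s , f∋s , si = proj₁ split₀ in false ∷ s , f∋s , refl , si
    shattered false false = let s , f∋s , si = proj₂ split₀ in false ∷ s , f∋s , refl , si
    shattered true true = let s , f∋s , si = proj₁ split₁ in true ∷ s , f∋s , refl , si
    shattered true false = let s , f∋s , si = proj₂ split₁ in true ∷ s , f∋s , refl , si

  splitCount-shadow : NoShatteredPair (f ∋_) → ∀ {a} → core f ∋ a →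
    splitCount (shadow f) ≡ splitCount f₀ + splitCount f₁
  splitCount-shadow noPair a∈core =
    trans (countFin-cong (splits-shadow a∈core))
          (countFin-disjoint (splits f₀) (splits f₁) (splits-exclusive noPair))

  tight-fibres : NoShatteredPair (f ∋_) → Tight f → bothFibres f ≡ true →
    (∃ λ a → core f ∋ a) × Tight f₀ × Tight f₁
  tight-fibres noPair tight both = core-member , squeeze sizes
    (size≤1+splitCount f₀ (noPair-fibre f false noPair))
    (size≤1+splitCount f₁ (noPair-fibre f true noPair))
    where
    core-member = member-of-size (core f)
      (≤-reflexive (sym (trans (proj₂ (tight-shadow-core f noPair tight)) (cong bit both))))
    sizes : size f₀ + size f₁ ≡ (1 + splitCount f₀) + (1 + splitCount f₁)
    sizes = begin
      size f                                          ≡⟨ tight ⟩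
      1 + splitCount f                                ≡⟨ cong suc (splitCount-suc f) ⟩
      1 + (bit (bothFibres f) + splitCount (shadow f))
        ≡⟨ cong (λ b → 1 + (bit b + splitCount (shadow f))) both ⟩
      2 + splitCount (shadow f)
        ≡⟨ cong (2 +_) (splitCount-shadow noPair (proj₂ core-member)) ⟩
      2 + (splitCount f₀ + splitCount f₁)              ≡⟨ cong suc (+-suc (splitCount f₀) _) ⟨
      (1 + splitCount f₀) + (1 + splitCount f₁)        ∎
      where open ≡-Reasoning

  one-fibre-shadow : ∀ b → Empty (fibre (not b) f) → ∀ s → shadow f s ≡ fibre b f s
  one-fibre-shadow false empty s = trans (cong (f₀ s ∨_) (empty s)) (∨-identityʳ _)
  one-fibre-shadow true empty s = cong (_∨ f₁ s) (empty s)

  one-fibre-not-both : ∀ b → Empty (fibre (not b) f) → bothFibres f ≡ false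
  one-fibre-not-both false empty =
    trans (cong (inhabited f₀ ∧_) (trans (inhabited-cong empty) (inhabited-nothing {n}))) (∧-zeroʳ _)
  one-fibre-not-both true empty = cong (_∧ inhabited f₁) (trans (inhabited-cong empty) (inhabited-nothing {n}))

  one-fibre-tight : ∀ b → Empty (fibre (not b) f) → Tight f → Tight (fibre b f)
  one-fibre-tight b empty tight = begin
    size (fibre b f)                                 ≡⟨ one-fibre-size f b empty ⟨
    size f                                           ≡⟨ tight ⟩
    1 + splitCount f                                 ≡⟨ cong suc (splitCount-suc f) ⟩
    1 + (bit (bothFibres f) + splitCount (shadow f))
      ≡⟨ cong (λ c → 1 + (bit c + splitCount (shadow f))) (one-fibre-not-both b empty) ⟩
    1 + splitCount (shadow f)                        ≡⟨ cong suc (splitCount-cong (one-fibre-shadow b empty)) ⟩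
    1 + splitCount (fibre b f)                       ∎
    where open ≡-Reasoning

  one-fibre-over : ∀ b → Empty (fibre (not b) f) → ∀ {c s} → f ∋ (c ∷ s) → c ≡ b
  one-fibre-over b empty {c} {s} f∋cs with c Bool.≟ b
  ... | yes c≡b = c≡b
  ... | no c≢b = ⊥-elim (false≢true (empty s) (subst (λ d → f (d ∷ s) ≡ true) (¬-not c≢b) f∋cs))

module _ {n} (f : Family (suc n)) where

  -- Connected fibres joined by a 0-edge at a core member a give a
  -- connected family: a walk between different fibres goes through a.
  fibres-connected : ∀ {a} → core f ∋ a → (∀ b → Connected′ (fibre b f ∋_)) → Connected′ (f ∋_)
  fibres-connected {a} a∈core fibre-connected {b ∷ g} {c ∷ h} f∋bg f∋ch with b Bool.≟ c
  ... | yes refl = fibre-walk f b (fibre-connected b f∋bg f∋ch)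
  ... | no b≢c =
    fibre-walk f b (fibre-connected b f∋bg (core⇒member f a b a∈core)) ++ᵂ
    move (across b c b≢c) (fibre-walk f c (fibre-connected c (core⇒member f a c a∈core) f∋ch))
    where
    across : ∀ b c → b ≢ c → Adj′ (f ∋_) (b ∷ a) (c ∷ a)
    across false true _ = zero , inj₁ (core⇒edge-zero f a∈core)
    across true false _ = zero , inj₂ (core⇒edge-zero f a∈core)
    across false false b≢c = ⊥-elim (b≢c refl)
    across true true b≢c = ⊥-elim (b≢c refl)

  one-fibre-connected : ∀ b → Empty (fibre (not b) f) → Connected′ (fibre b f ∋_) → Connected′ (f ∋_)
  one-fibre-connected b empty connected {c ∷ g} {d ∷ h} f∋cg f∋dh
    with refl ← one-fibre-over f b empty f∋cg | refl ← one-fibre-over f b empty f∋dh =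
    fibre-walk f b (connected f∋cg f∋dh)

-- By induction on n:
-- if both fibres are inhabited they are tight, hence connected, and they
-- meet in the core; otherwise f is a copy of its only inhabited fibre.
tight⇒connected : ∀ {n} (f : Family n) → NoShatteredPair (f ∋_) → Tight f → Connected′ (f ∋_)
tight⇒connected {zero} f _ _ {[]} {[]} _ _ = stay
tight⇒connected {suc n} f noPair tight with fibre-cases f
... | inj₁ both =
  let (a , a∈core) , tight₀ , tight₁ = tight-fibres f noPair tight both
      fibre-connected : ∀ b → Connected′ (fibre b f ∋_)
      fibre-connected = λ where
        false → tight⇒connected _ (noPair-fibre f false noPair) tight₀
        true → tight⇒connected _ (noPair-fibre f true noPair) tight₁
  in fibres-connected f a∈core fibre-connected
... | inj₂ (b , empty) = one-fibre-connected f b empty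
  (tight⇒connected (fibre b f) (noPair-fibre f b noPair) (one-fibre-tight f b empty tight))

single : ∀ {n} → Subset n → Family n
single x s = does (s ≟ˢ x)

single-∋ : ∀ {n} {x s : Subset n} → single x ∋ s → s ≡ x
single-∋ {x = x} {s} s∈ with s ≟ˢ x
... | yes s≡x = s≡x

single-self : ∀ {n} (x : Subset n) → single x ∋ x
single-self x with x ≟ˢ x
... | yes _ = refl
... | no x≢x = ⊥-elim (x≢x refl)

size-single : ∀ {n} (x : Subset n) → size (single x) ≡ 1
size-single x = ≤-antisym
  (size≤1 (single x) λ s t s∈ t∈ → trans (single-∋ s∈) (sym (single-∋ t∈)))
  (size-member (single x) x (single-self x))

size-disjoint : ∀ {n} (f g : Family n) → Empty (f ∩ᶠ g) → size (f ∪ᶠ g) ≡ size f + size g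
size-disjoint f g disjoint =
  trans (sym (+-identityʳ _)) (trans (cong (size (f ∪ᶠ g) +_) (sym (size-empty (f ∩ᶠ g) disjoint)))
                                     (size-∪∩ f g))

⟦_⟧ : ∀ {n} → List (Subset n) → Family n
⟦ [] ⟧ s = false
⟦ x ∷ xs ⟧ s = single x s ∨ ⟦ xs ⟧ s

⟦⟧-sound : ∀ {n} (xs : List (Subset n)) {s} → ⟦ xs ⟧ ∋ s → s ∈ xs
⟦⟧-sound (x ∷ xs) {s} s∈ with ∨-elim (single x s) s∈
... | inj₁ s≡x = here (single-∋ s≡x)
... | inj₂ s∈xs = there (⟦⟧-sound xs s∈xs)

⟦⟧-complete : ∀ {n} (xs : List (Subset n)) {s} → s ∈ xs → ⟦ xs ⟧ ∋ s
⟦⟧-complete (x ∷ xs) (here refl) = ∨-introˡ (⟦ xs ⟧ x) (single-self x)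
⟦⟧-complete (x ∷ xs) {s} (there s∈xs) = ∨-introʳ (single x s) (⟦⟧-complete xs s∈xs)

⟦⟧⇔∈ : ∀ {n} (xs : List (Subset n)) {s} → ⟦ xs ⟧ ∋ s ⇔ s ∈ xs
⟦⟧⇔∈ xs = mk⇔ (⟦⟧-sound xs) (⟦⟧-complete xs)

length≡size : ∀ {n} (xs : List (Subset n)) → Unique xs → length xs ≡ size ⟦ xs ⟧
length≡size {n} [] _ = sym (size-empty (⟦_⟧ {n} []) λ _ → refl)
length≡size (x ∷ xs) (x∉xs ∷ unique) = begin
  1 + length xs                 ≡⟨ cong₂ _+_ (sym (size-single x)) (length≡size xs unique) ⟩
  size (single x) + size ⟦ xs ⟧ ≡⟨ size-disjoint (single x) ⟦ xs ⟧ disjoint ⟨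
  size ⟦ x ∷ xs ⟧               ∎
  where
  open ≡-Reasoning
  disjoint : Empty (single x ∩ᶠ ⟦ xs ⟧)
  disjoint s with bool-cases (single x s ∧ ⟦ xs ⟧ s)
  ... | inj₂ none = none
  ... | inj₁ both with single-∋ {x = x} {s} (∧-elimˡ both)
  ...   | refl = ⊥-elim (All.lookup x∉xs (⟦⟧-sound xs (∧-elimʳ both)) refl)

members : ∀ {n} → Family n → List (Subset n)
members {zero} f = if f [] then [] ∷ [] else []
members {suc n} f = map (false ∷_) (members (fibre false f)) ++ map (true ∷_) (members (fibre true f))

length-members : ∀ {n} (f : Family n) → length (members f) ≡ size f
length-members {zero} f with f []
... | true = refl
... | false = refl
length-members {suc n} f = begin
  length (map (false ∷_) (members f₀) ++ map (true ∷_) (members f₁))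
    ≡⟨ length-++ (map (false ∷_) (members f₀)) ⟩
  length (map (false ∷_) (members f₀)) + length (map (true ∷_) (members f₁))
    ≡⟨ cong₂ _+_ (length-map (false ∷_) (members f₀)) (length-map (true ∷_) (members f₁)) ⟩
  length (members f₀) + length (members f₁)
    ≡⟨ cong₂ _+_ (length-members f₀) (length-members f₁) ⟩
  size f ∎
  where
  open ≡-Reasoning
  f₀ = fibre false f; f₁ = fibre true f

members-sound : ∀ {n} (f : Family n) {s} → s ∈ members f → f ∋ s
members-sound {zero} f {[]} s∈ with f []
members-sound {zero} f {[]} (here refl) | true = refl
... | false with () ← s∈
members-sound {suc n} f s∈ with ∈-++⁻ (map (false ∷_) (members (fibre false f))) s∈
... | inj₁ s∈₀ with _ , t∈ , refl ← ∈-map⁻ (false ∷_) s∈₀ = members-sound (fibre false f) t∈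
... | inj₂ s∈₁ with _ , t∈ , refl ← ∈-map⁻ (true ∷_) s∈₁ = members-sound (fibre true f) t∈

members-complete : ∀ {n} (f : Family n) {s} → f ∋ s → s ∈ members f
members-complete {zero} f {[]} f∋[] rewrite f∋[] = here refl
members-complete {suc n} f {false ∷ s} f∋s =
  ∈-++⁺ˡ (∈-map⁺ (false ∷_) (members-complete (fibre false f) f∋s))
members-complete {suc n} f {true ∷ s} f∋s =
  ∈-++⁺ʳ (map (false ∷_) (members (fibre false f)))
         (∈-map⁺ (true ∷_) (members-complete (fibre true f) f∋s))

members-unique : ∀ {n} (f : Family n) → Unique (members f)
members-unique {zero} f with f []
... | true = [] ∷ []
... | false = []
members-unique {suc n} f = ++⁺ (map⁺ ∷-injectiveʳ (members-unique (fibre false f)))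
                               (map⁺ ∷-injectiveʳ (members-unique (fibre true f))) disjoint
  where
  disjoint : ∀ {v} → ¬ (v ∈ map (false ∷_) (members (fibre false f)) ×
                        v ∈ map (true ∷_) (members (fibre true f)))
  disjoint (v∈₀ , v∈₁) with ∈-map⁻ (false ∷_) v∈₀ | ∈-map⁻ (true ∷_) v∈₁
  ... | _ , _ , refl | _ , _ , ()

-- The sets shattered by a nonempty family f without shattered pairs:
-- ∅ and the singletons {i} of the coordinates i splitting f.
shatteredSets : ∀ {n} → Family n → Family n
shatteredSets {zero} f [] = true
shatteredSets {suc n} f (false ∷ s) = shatteredSets (shadow f) s
shatteredSets {suc n} f (true ∷ s) = bothFibres f ∧ single ∅ s

size-shatteredSets : ∀ {n} (f : Family n) → size (shatteredSets f) ≡ 1 + splitCount f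
size-shatteredSets {zero} f = refl
size-shatteredSets {suc n} f = begin
  size (shatteredSets (shadow f)) + size (fibre true (shatteredSets f))
    ≡⟨ cong₂ _+_ (size-shatteredSets (shadow f)) (size-singleton-if (bothFibres f)) ⟩
  (1 + splitCount (shadow f)) + bit (bothFibres f)
    ≡⟨ 1+splitCount-suc f ⟨
  1 + splitCount f ∎
  where
  open ≡-Reasoning
  size-singleton-if : ∀ b → size {n} (λ s → b ∧ single ∅ s) ≡ bit b
  size-singleton-if true = size-single (∅ {n})
  size-singleton-if false = size-empty {n} (λ _ → false) λ _ → refl

shatteredSets-∅ : ∀ {n} (f : Family n) → shatteredSets f ∋ ∅
shatteredSets-∅ {zero} f = refl
shatteredSets-∅ {suc n} f = shatteredSets-∅ (shadow f)

shatteredSets-⁅⁆ : ∀ {n} (f : Family n) i → splits f i ≡ true → shatteredSets f ∋ ⁅ i ⁆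
shatteredSets-⁅⁆ {suc n} f zero split = ∧-intro (trans (sym (splits-zero f)) split) (single-self (∅ {n}))
shatteredSets-⁅⁆ {suc n} f (suc i) split = shatteredSets-⁅⁆ (shadow f) i (trans (sym (splits-suc f i)) split)

shatteredSets-cases : ∀ {n} (f : Family n) S → shatteredSets f ∋ S →
  S ≡ ∅ ⊎ ∃ λ i → S ≡ ⁅ i ⁆ × splits f i ≡ true
shatteredSets-cases {zero} f [] _ = inj₁ refl
shatteredSets-cases {suc n} f (false ∷ s) s∈ with shatteredSets-cases (shadow f) s s∈
... | inj₁ refl = inj₁ refl
... | inj₂ (i , refl , split) = inj₂ (suc i , refl , trans (splits-suc f i) split)
shatteredSets-cases {suc n} f (true ∷ s) s∈ with single-∋ {x = ∅} {s} (∧-elimʳ {bothFibres f} s∈)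
... | refl = inj₂ (zero , refl , trans (splits-zero f) (∧-elimˡ s∈))

module _ {n} {F S T : Subset n} where

  trace-≡ : T ⊆ S → (∀ {k} → k ∈ₛ S → lookup F k ≡ lookup T k) → F ∩ S ≡ T
  trace-≡ T⊆S agree = subset-ext λ k → trans (lookup-zipWith _∧_ k F S) (at k (bool-cases (lookup S k)))
    where
    at : ∀ k → lookup S k ≡ true ⊎ lookup S k ≡ false → lookup F k ∧ lookup S k ≡ lookup T k
    at k (inj₁ k∈S) rewrite k∈S = trans (∧-identityʳ _) (agree (lookup⇒[]= k S k∈S))
    at k (inj₂ k∉S) rewrite k∉S =
      trans (∧-zeroʳ _) (sym (∉⇒lookup λ k∈T → false≢true k∉S ([]=⇒lookup (T⊆S k∈T))))

  trace-at : F ∩ S ≡ T → ∀ {k} → k ∈ₛ S → lookup F k ≡ lookup T k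
  trace-at F∩S≡T {k} k∈S = begin
    lookup F k                ≡⟨ ∧-identityʳ _ ⟨
    lookup F k ∧ true         ≡⟨ cong (lookup F k ∧_) ([]=⇒lookup k∈S) ⟨
    lookup F k ∧ lookup S k   ≡⟨ lookup-zipWith _∧_ k F S ⟨
    lookup (F ∩ S) k          ≡⟨ cong (λ U → lookup U k) F∩S≡T ⟩
    lookup T k                ∎
    where open ≡-Reasoning

agree-on-⁅⁆ : ∀ {n} {F T : Subset n} {l} → lookup F l ≡ lookup T l →
  ∀ {k} → k ∈ₛ ⁅ l ⁆ → lookup F k ≡ lookup T k
agree-on-⁅⁆ {l = l} agree k∈⁅l⁆ rewrite x∈⁅y⁆⇒x≡y l k∈⁅l⁆ = agree

∣S∣≤0⇒∅ : ∀ {n} (S : Subset n) → ∣ S ∣ ≤ 0 → S ≡ ∅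
∣S∣≤0⇒∅ [] _ = refl
∣S∣≤0⇒∅ (false ∷ S) bound = cong (false ∷_) (∣S∣≤0⇒∅ S bound)

∣S∣≤1⇒∅∨⁅⁆ : ∀ {n} (S : Subset n) → ∣ S ∣ ≤ 1 → S ≡ ∅ ⊎ ∃ λ i → S ≡ ⁅ i ⁆
∣S∣≤1⇒∅∨⁅⁆ [] _ = inj₁ refl
∣S∣≤1⇒∅∨⁅⁆ (true ∷ S) (s≤s bound) = inj₂ (zero , cong (true ∷_) (∣S∣≤0⇒∅ S bound))
∣S∣≤1⇒∅∨⁅⁆ (false ∷ S) bound with ∣S∣≤1⇒∅∨⁅⁆ S bound
... | inj₁ refl = inj₁ refl
... | inj₂ (i , refl) = inj₂ (suc i , refl)

some-member : ∀ {n} (S : Subset n) → 1 ≤ ∣ S ∣ → ∃ λ i → i ∈ₛ S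
some-member (true ∷ S) _ = zero , at-head
some-member (false ∷ S) 1≤∣S∣ = let i , i∈S = some-member S 1≤∣S∣ in suc i , in-tail i∈S

two-members : ∀ {n} (S : Subset n) → 2 ≤ ∣ S ∣ →
  Σ (Fin n) λ i → Σ (Fin n) λ j → i ≢ j × i ∈ₛ S × j ∈ₛ S
two-members (true ∷ S) (s≤s 1≤∣S∣) =
  let j , j∈S = some-member S 1≤∣S∣ in zero , suc j , (λ ()) , at-head , in-tail j∈S
two-members (false ∷ S) 2≤∣S∣ =
  let i , j , i≢j , i∈S , j∈S = two-members S 2≤∣S∣ in
  suc i , suc j , i≢j ∘ suc-injective , in-tail i∈S , in-tail j∈S

∣pair∣ : ∀ {n} {i j : Fin n} → i ≢ j → 2 ≤ ∣ ⁅ i ⁆ ∪ ⁅ j ⁆ ∣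
∣pair∣ {i = i} {j} i≢j = subst (λ m → suc m ≤ ∣ ⁅ i ⁆ ∪ ⁅ j ⁆ ∣) (∣⁅x⁆∣≡1 i) (p⊂q⇒∣p∣<∣q∣ ⁅i⁆⊂pair)
  where
  ⁅i⁆⊂pair : ⁅ i ⁆ ⊂ ⁅ i ⁆ ∪ ⁅ j ⁆
  ⁅i⁆⊂pair = p⊆p∪q ⁅ j ⁆ , j , x∈p∪q⁺ (inj₂ (x∈⁅x⁆ j)) , λ j∈⁅i⁆ → i≢j (sym (x∈⁅y⁆⇒x≡y i j∈⁅i⁆))

module _ {n} (𝓕 : List (Subset n)) where

  shatters-∅ : ∀ {G} → G ∈ 𝓕 → Shatters 𝓕 ∅
  shatters-∅ {G} G∈𝓕 T T⊆∅ = G , G∈𝓕 , trace-≡ T⊆∅ λ {k} k∈∅ →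
    ⊥-elim (false≢true (lookup-∅ k) ([]=⇒lookup k∈∅))

  shatters-⁅⁆⇒splits : ∀ i → Shatters 𝓕 ⁅ i ⁆ → splits ⟦ 𝓕 ⟧ i ≡ true
  shatters-⁅⁆⇒splits i shattered
    with shattered ⁅ i ⁆ (λ k∈ → k∈) | shattered ∅ ⊥⊆
  ... | F , F∈𝓕 , F-trace | F′ , F′∈𝓕 , F′-trace =
    splits-complete ⟦ 𝓕 ⟧ i F F′
      (⟦⟧-complete 𝓕 F∈𝓕) (trans (trace-at F-trace i∈) (lookup-⁅⁆ i))
      (⟦⟧-complete 𝓕 F′∈𝓕) (trans (trace-at F′-trace i∈) (lookup-∅ i))
    where i∈ = x∈⁅x⁆ i

  splits⇒shatters-⁅⁆ : ∀ i → splits ⟦ 𝓕 ⟧ i ≡ true → Shatters 𝓕 ⁅ i ⁆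
  splits⇒shatters-⁅⁆ i split T T⊆⁅i⁆ = with-value (bool-cases (lookup T i))
    where
    witnesses = splits-sound ⟦ 𝓕 ⟧ i split
    member-with : ∀ {F} → ⟦ 𝓕 ⟧ ∋ F → lookup F i ≡ lookup T i → ∃ λ F → F ∈ 𝓕 × F ∩ ⁅ i ⁆ ≡ T
    member-with {F} F∈ Fi≡Ti =
      F , ⟦⟧-sound 𝓕 F∈ , trace-≡ T⊆⁅i⁆ (agree-on-⁅⁆ {F = F} {T} Fi≡Ti)
    with-value : lookup T i ≡ true ⊎ lookup T i ≡ false → ∃ λ F → F ∈ 𝓕 × F ∩ ⁅ i ⁆ ≡ T
    with-value (inj₁ i∈T) = let s , s∈ , i∈s = proj₁ witnesses in member-with s∈ (trans i∈s (sym i∈T))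
    with-value (inj₂ i∉T) = let t , t∈ , i∉t = proj₂ witnesses in member-with t∈ (trans i∉t (sym i∉T))

  pair⇒shatters : ∀ {i j} → ShattersPair (_∈ 𝓕) i j → Shatters 𝓕 (⁅ i ⁆ ∪ ⁅ j ⁆)
  pair⇒shatters {i} {j} shattered T T⊆pair =
    let F , F∈𝓕 , Fi , Fj = shattered (lookup T i) (lookup T j) in
    F , F∈𝓕 , trace-≡ T⊆pair λ k∈ →
      [ agree-on-⁅⁆ {F = F} {T} Fi , agree-on-⁅⁆ {F = F} {T} Fj ]′ (x∈p∪q⁻ ⁅ i ⁆ ⁅ j ⁆ k∈)

  shatters⇒pair : ∀ {S i j} → Shatters 𝓕 S → i ≢ j → i ∈ₛ S → j ∈ₛ S → ShattersPair (_∈ 𝓕) i j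
  shatters⇒pair {S} {i} {j} shattered i≢j i∈S j∈S b c =
    let F , F∈𝓕 , F-trace = shattered T T⊆S in
    F , F∈𝓕 , trans (trace-at F-trace i∈S) Ti , trans (trace-at F-trace j∈S) Tj
    where
    wanted : Fin n → Bool
    wanted k = if does (k Fin.≟ i) then b else c
    T = tabulate λ k → lookup S k ∧ wanted k
    T⊆S : T ⊆ S
    T⊆S {k} k∈T = lookup⇒[]= k S (∧-elimˡ (trans (sym (lookup∘tabulate _ k)) ([]=⇒lookup k∈T)))
    value : ∀ {k} → k ∈ₛ S → lookup T k ≡ wanted k
    value {k} k∈S = trans (lookup∘tabulate _ k) (cong (_∧ wanted k) ([]=⇒lookup k∈S))
    Ti : lookup T i ≡ b
    Ti with i Fin.≟ i | value i∈S
    ... | yes _ | Ti≡b = Ti≡b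
    ... | no i≢i | _ = ⊥-elim (i≢i refl)
    Tj : lookup T j ≡ c
    Tj with j Fin.≟ i | value j∈S
    ... | yes j≡i | _ = ⊥-elim (i≢j (sym j≡i))
    ... | no _ | Tj≡c = Tj≡c

  vc≤1⇒noPair : VCdim≤1 𝓕 → NoShatteredPair (_∈ 𝓕)
  vc≤1⇒noPair vc i j i≢j shattered
    with s≤s () ← ≤-trans (∣pair∣ i≢j) (vc _ (pair⇒shatters shattered))

  noPair⇒vc≤1 : NoShatteredPair (_∈ 𝓕) → VCdim≤1 𝓕
  noPair⇒vc≤1 noPair S shattered with ∣ S ∣ ≤? 1
  ... | yes bound = bound
  ... | no unbounded =
    let i , j , i≢j , i∈S , j∈S = two-members S (≰⇒> unbounded)
    in ⊥-elim (noPair i j i≢j (shatters⇒pair shattered i≢j i∈S j∈S))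

  shatters⇔shatteredSets : ∀ {G} → G ∈ 𝓕 → VCdim≤1 𝓕 →
    ∀ S → Shatters 𝓕 S ⇔ shatteredSets ⟦ 𝓕 ⟧ ∋ S
  shatters⇔shatteredSets G∈𝓕 vc S = mk⇔ to from
    where
    to : Shatters 𝓕 S → shatteredSets ⟦ 𝓕 ⟧ ∋ S
    to shattered with ∣S∣≤1⇒∅∨⁅⁆ S (vc S shattered)
    ... | inj₁ refl = shatteredSets-∅ ⟦ 𝓕 ⟧
    ... | inj₂ (i , refl) = shatteredSets-⁅⁆ ⟦ 𝓕 ⟧ i (shatters-⁅⁆⇒splits i shattered)
    from : shatteredSets ⟦ 𝓕 ⟧ ∋ S → Shatters 𝓕 S
    from S∈ with shatteredSets-cases ⟦ 𝓕 ⟧ S S∈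
    ... | inj₁ refl = shatters-∅ G∈𝓕
    ... | inj₂ (i , refl , split) = splits⇒shatters-⁅⁆ i split

module _ {n} {M M′ : Subset n → Set} (M′⊆M : ∀ {s} → M′ s → M s) where

  edge-mono : ∀ {G F j} → Edge′ M′ G F j → Edge′ M G F j
  edge-mono (G∈ , F∈ , j∉G , F≡) = M′⊆M G∈ , M′⊆M F∈ , j∉G , F≡

  walk-mono : ∀ {G H} → Walk′ M′ G H → Walk′ M G H
  walk-mono stay = stay
  walk-mono (move (j , inj₁ e) w) = move (j , inj₁ (edge-mono e)) (walk-mono w)
  walk-mono (move (j , inj₂ e) w) = move (j , inj₂ (edge-mono e)) (walk-mono w)

  connected-mono : (∀ {s} → M s → M′ s) → Connected′ M′ → Connected′ M
  connected-mono M⊆M′ connected G∈ H∈ = walk-mono (connected (M⊆M′ G∈) (M⊆M′ H∈))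

  distinct-mono : DistinctLabels′ M → DistinctLabels′ M′
  distinct-mono distinct e₁ e₂ = distinct (edge-mono e₁) (edge-mono e₂)

  noPair-mono : NoShatteredPair M → NoShatteredPair M′
  noPair-mono noPair i j i≢j shattered = noPair i j i≢j λ b c →
    let s , M′s , si , sj = shattered b c in s , M′⊆M M′s , si , sj

module _ {n} {𝓕 : List (Subset n)} where

  fromWalk : ∀ {G H} → Walk 𝓕 G H → Walk′ (_∈ 𝓕) G H
  fromWalk here = stay
  fromWalk (step a w) = move a (fromWalk w)

  toWalk : ∀ {G H} → Walk′ (_∈ 𝓕) G H → Walk 𝓕 G H
  toWalk stay = here
  toWalk (move a w) = step a (toWalk w)

same-members : ∀ {n} {f g : Family n} → (∀ s → f ∋ s ⇔ g ∋ s) → ∀ s → f s ≡ g s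
same-members {f = f} {g} same s with f s | g s | same s
... | true | _ | f⇔g = sym (Equivalence.to f⇔g refl)
... | false | true | f⇔g = Equivalence.from f⇔g refl
... | false | false | _ = refl

-- For a nonempty duplicate-free list 𝓕 of VC dimension at most 1,
-- s-extremality says exactly that ⟦ 𝓕 ⟧ is tight: both mean
-- |𝓕| = |Sh(𝓕)| = 1 + (number of splitting coordinates).
module _ {n} {𝓕 : List (Subset n)} {G} (G∈𝓕 : G ∈ 𝓕) (unique : Unique 𝓕) (vc : VCdim≤1 𝓕) where

  private
    shattered = shatters⇔shatteredSets 𝓕 G∈𝓕 vc

  sExtremal⇒tight : SExtremal 𝓕 → Tight ⟦ 𝓕 ⟧
  sExtremal⇒tight (Sh , Sh-unique , ∈Sh⇔shatters , |Sh|≡|𝓕|) = begin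
    size ⟦ 𝓕 ⟧                   ≡⟨ length≡size 𝓕 unique ⟨
    length 𝓕                     ≡⟨ |Sh|≡|𝓕| ⟨
    length Sh                    ≡⟨ length≡size Sh Sh-unique ⟩
    size ⟦ Sh ⟧                  ≡⟨ size-cong (same-members λ S →
                                      shattered S ⇔-∘ (∈Sh⇔shatters S ⇔-∘ ⟦⟧⇔∈ Sh)) ⟩
    size (shatteredSets ⟦ 𝓕 ⟧)   ≡⟨ size-shatteredSets ⟦ 𝓕 ⟧ ⟩
    1 + splitCount ⟦ 𝓕 ⟧         ∎
    where open ≡-Reasoning

  tight⇒sExtremal : Tight ⟦ 𝓕 ⟧ → SExtremal 𝓕
  tight⇒sExtremal tight =
    members (shatteredSets ⟦ 𝓕 ⟧) , members-unique (shatteredSets ⟦ 𝓕 ⟧) , listed , (begin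
    length (members (shatteredSets ⟦ 𝓕 ⟧)) ≡⟨ length-members (shatteredSets ⟦ 𝓕 ⟧) ⟩
    size (shatteredSets ⟦ 𝓕 ⟧)             ≡⟨ size-shatteredSets ⟦ 𝓕 ⟧ ⟩
    1 + splitCount ⟦ 𝓕 ⟧                   ≡⟨ tight ⟨
    size ⟦ 𝓕 ⟧                             ≡⟨ length≡size 𝓕 unique ⟨
    length 𝓕                               ∎)
    where
    open ≡-Reasoning
    listed : ∀ S → S ∈ members (shatteredSets ⟦ 𝓕 ⟧) ⇔ Shatters 𝓕 S
    listed S = mk⇔ (Equivalence.from (shattered S) ∘ members-sound _)
                   (members-complete _ ∘ Equivalence.to (shattered S))

mainTheorem1 : (n : ℕ) → n ≥ 1 → (𝓕 : List (Subset n)) → Unique 𝓕 → 𝓕 ≢ [] →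
    (SExtremal 𝓕 × VCdim≤1 𝓕) ⇔ (IsTree 𝓕 × DistinctLabels 𝓕)
mainTheorem1 n _ [] _ 𝓕≢[] = ⊥-elim (𝓕≢[] refl)
mainTheorem1 n _ 𝓕@(G ∷ _) unique _ = mk⇔ forward backward
  where
  f : Family n
  f = ⟦ 𝓕 ⟧
  G∈𝓕 : G ∈ 𝓕
  G∈𝓕 = here refl

  forward : SExtremal 𝓕 × VCdim≤1 𝓕 → IsTree 𝓕 × DistinctLabels 𝓕
  forward (sExtremal , vc) = ((G , G∈𝓕) , connected , distinctLabels⇒acyclic 𝓕 distinct) , distinct
    where
    noPair : NoShatteredPair (f ∋_)
    noPair = noPair-mono (⟦⟧-sound 𝓕) (vc≤1⇒noPair 𝓕 vc)
    tight : Tight f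
    tight = sExtremal⇒tight G∈𝓕 unique vc sExtremal
    distinct : DistinctLabels 𝓕
    distinct = distinct-mono (⟦⟧-complete 𝓕) (tight⇒distinctLabels f noPair tight)
    connected : Connected 𝓕
    connected G∈ H∈ =
      toWalk (connected-mono (⟦⟧-sound 𝓕) (⟦⟧-complete 𝓕) (tight⇒connected f noPair tight) G∈ H∈)

  backward : IsTree 𝓕 × DistinctLabels 𝓕 → SExtremal 𝓕 × VCdim≤1 𝓕
  backward ((_ , connected , _) , distinct) = tight⇒sExtremal G∈𝓕 unique vc tight , vc
    where
    connected′ : Connected′ (_∈ 𝓕)
    connected′ G∈ H∈ = fromWalk (connected G∈ H∈)
    noPair : NoShatteredPair (_∈ 𝓕)
    noPair = connected⇒noPair connected′ distinct
    vc : VCdim≤1 𝓕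
    vc = noPair⇒vc≤1 𝓕 noPair
    tight : Tight f
    tight = ≤-antisym (size≤1+splitCount f (noPair-mono (⟦⟧-sound 𝓕) noPair))
      (connected⇒1+splitCount≤size f (connected-mono (⟦⟧-complete 𝓕) (⟦⟧-sound 𝓕) connected′)
                                      (G , ⟦⟧-complete 𝓕 G∈𝓕))
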